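{- Let $A$ and $B$ be two pure partial planes of the same order $n$, neither of which is a finite projective plane. Then $A$ and $B$ are isomorphic if and only if their point-line-adjacency graphs are isomorphic (as graphs).
   Context: A pure partial plane of order $n$ and size $s$ is a set $X$ of $n^2+n+1$ points together with a collection of $s$ distinct lines, each line being a subset of $X$ of cardinality $n+1$, such that any two distinct lines intersect in exactly one point. A finite projective plane of order $n$ is one with $n^2+n+1$ lines in which additionally every point is on $n+1$ lines and any two distinct points lie on exactly one line. Two pure partial planes are isomorphic if there are a bijection between their point sets and a bijection between their line sets preserving incidence. The point-line-adjacency graph of a pure partial plane of order $n$ and size $s$ is the simple undirected bipartite graph on $n^2+n+1+s$ vertices, one vertex for each point (including points on no line) and one for each line, in which a line-vertex is adjacent to a point-vertex exactly when the line contains the point. -}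

module Defs where

open import Data.Nat using (ℕ; suc; _+_; _*_)
open import Data.Fin using (Fin)
open import Data.Fin.Subset using (Subset; _∈_; _∩_; ∣_∣)
open import Data.Vec using (tabulate)
open import Data.Product using (Σ; _×_)
open import Data.Sum using (_⊎_; inj₁; inj₂)
open import Data.Empty using (⊥)
open import Relation.Binary.PropositionalEquality using (_≡_; _≢_)
open import Function.Bundles using (_↔_; _⇔_; Inverse)

numPoints : ℕ → ℕ
numPoints n = n * n + n + 1

record PurePartialPlane (n : ℕ) : Set where
  field
    size        : ℕ
    line        : Fin size → Subset (numPoints n)
    line-card   : ∀ l → ∣ line l ∣ ≡ suc n
    line-inj    : ∀ l m → line l ≡ line m → l ≡ m
    line-meet   : ∀ l m → l ≢ m → ∣ line l ∩ line m ∣ ≡ 1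

  linesThrough : Fin (numPoints n) → Subset size
  linesThrough p = tabulate (λ l → Data.Vec.lookup (line l) p)

open PurePartialPlane public

IsProjectivePlane : ∀ {n} → PurePartialPlane n → Set
IsProjectivePlane {n} A =
  (size A ≡ numPoints n)
  × (∀ p → ∣ linesThrough A p ∣ ≡ suc n)
  × (∀ p q → p ≢ q →
       Σ (Fin (size A)) λ l → (p ∈ line A l × q ∈ line A l)
         × (∀ m → p ∈ line A m → q ∈ line A m → m ≡ l))

PPPIso : ∀ {n} → PurePartialPlane n → PurePartialPlane n → Set
PPPIso {n} A B =
  Σ (Fin (numPoints n) ↔ Fin (numPoints n)) λ φ →
  Σ (Fin (size A) ↔ Fin (size B)) λ ψ →
    ∀ p l → (p ∈ line A l) ⇔ (Inverse.to φ p ∈ line B (Inverse.to ψ l))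

Vertex : ∀ {n} → PurePartialPlane n → Set
Vertex {n} A = Fin (numPoints n) ⊎ Fin (size A)

Adj : ∀ {n} (A : PurePartialPlane n) → Vertex A → Vertex A → Set
Adj A (inj₁ p) (inj₂ l) = p ∈ line A l
Adj A (inj₂ l) (inj₁ p) = p ∈ line A l
Adj A (inj₁ _) (inj₁ _) = ⊥
Adj A (inj₂ _) (inj₂ _) = ⊥

GraphIso : ∀ {n} → PurePartialPlane n → PurePartialPlane n → Set
GraphIso A B =
  Σ (Vertex A ↔ Vertex B) λ ι →
    ∀ u v → Adj A u v ⇔ Adj B (Inverse.to ι u) (Inverse.to ι v)

-- If a graph isomorphism sends some line l₀ of A to a point, then it sends every line to a
-- point (each line meets l₀, and sides alternate along edges), hence every point on a line
-- to a line of B, whose n + 1 points give that point degree n + 1. The full pencil of lines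
-- through a point of l₀ covers 1 + (n + 1)n = n² + n + 1 points, i.e. all of them, so the
-- isomorphism swaps points and lines outright. Then A has exactly n² + n + 1 lines, every
-- point has degree n + 1, and two points p, q are joined by the preimage of the point where
-- their image lines meet: A is a projective plane. So if neither plane is projective, the
-- isomorphism and its inverse send lines to lines, hence points to points, and it restricts
-- to an isomorphism of partial planes.
module Submission where

open import Data.Nat using (ℕ; suc; _+_; _*_; _≤_; _<_; s≤s)
open import Data.Nat.Properties using (≤-antisym; <-irrefl; +-comm)
open import Data.Fin using (Fin; zero; suc; punchIn; punchOut; _≟_)
open import Data.Fin.Properties
  using (injective⇒≤; cantor-schröder-bernstein; suc-injective; punchIn-injective;
         punchInᵢ≢i; punchOut-injective; *↔×)
open import Data.Fin.Subset using (Subset; _∈_; _∉_; ∣_∣; inside; outside; _∩_; Nonempty)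
open import Data.Fin.Subset.Properties using (x∈p∩q⁺; x∈p∩q⁻)
open import Data.Vec using (_∷_)
open import Data.Vec.Base using (here; there)
open import Data.Vec.Properties using (lookup∘tabulate; []=⇒lookup; lookup⇒[]=)
open import Data.Product using (Σ; ∃; _×_; _,_; proj₁; proj₂)
open import Data.Sum using (_⊎_; inj₁; inj₂)
open import Data.Sum.Properties using (inj₁-injective; inj₂-injective)
open import Data.Sum.Function.Propositional using (_⊎-↔_)
open import Data.Empty using (⊥-elim)
open import Function using (_∘_)
open import Function.Bundles using (_↔_; _⇔_; Inverse; Equivalence; Bijection; mk⇔; mk↔ₛ′)
open import Function.Definitions using (Injective)
open import Function.Properties.Inverse using (↔⇒⤖)
open import Function.Construct.Symmetry using (↔-sym)
open import Relation.Binary.PropositionalEquality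
open import Relation.Nullary using (¬_; yes; no)
open import Defs

private
  variable
    k c : ℕ

↔-injective : ∀ {X Y : Set} (ι : X ↔ Y) → Injective _≡_ _≡_ (Inverse.to ι)
↔-injective ι = Bijection.injective (↔⇒⤖ ι)

injective∧missing⇒< : ∀ {a b} {f : Fin a → Fin b} → Injective _≡_ _≡_ f →
                      (y : Fin b) → (∀ x → f x ≢ y) → a < b
injective∧missing⇒< {b = suc b} f-injective y f≢y =
  s≤s (injective⇒≤ λ {x} {x′} e →
    f-injective (punchOut-injective (f≢y x ∘ sym) (f≢y x′ ∘ sym) e))

↔-restrict : ∀ {V W X Y : Set} (ι : V ↔ W) {i : X → V} {j : Y → W} →
             Injective _≡_ _≡_ i → Injective _≡_ _≡_ j →
             (∀ x → ∃ λ y → Inverse.to ι (i x) ≡ j y) →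
             (∀ y → ∃ λ x → Inverse.from ι (j y) ≡ i x) →
             Σ (X ↔ Y) λ φ → ∀ x → Inverse.to ι (i x) ≡ j (Inverse.to φ x)
↔-restrict {X = X} {Y} ι {i} {j} i-injective j-injective to-i from-j =
  mk↔ₛ′ (proj₁ ∘ to-i) (proj₁ ∘ from-j) to∘from from∘to , proj₂ ∘ to-i
  where
  open Inverse ι
  to∘from : ∀ y → proj₁ (to-i (proj₁ (from-j y))) ≡ y
  to∘from y = j-injective (begin
    j (proj₁ (to-i x))  ≡⟨ proj₂ (to-i x) ⟨
    to (i x)            ≡⟨ cong to (proj₂ (from-j y)) ⟨
    to (from (j y))     ≡⟨ strictlyInverseˡ (j y) ⟩
    j y                 ∎)
    where
    open ≡-Reasoning
    x : X
    x = proj₁ (from-j y)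
  from∘to : ∀ x → proj₁ (from-j (proj₁ (to-i x))) ≡ x
  from∘to x = i-injective (↔-injective ι (begin
    to (i (proj₁ (from-j y)))  ≡⟨ cong to (proj₂ (from-j y)) ⟨
    to (from (j y))            ≡⟨ strictlyInverseˡ (j y) ⟩
    j y                        ≡⟨ proj₂ (to-i x) ⟨
    to (i x)                   ∎))
    where
    open ≡-Reasoning
    y : Y
    y = proj₁ (to-i x)

member : (S : Subset k) → Fin ∣ S ∣ → Fin k
member (inside  ∷ S) zero    = zero
member (inside  ∷ S) (suc i) = suc (member S i)
member (outside ∷ S) i       = suc (member S i)

member-∈ : (S : Subset k) (i : Fin ∣ S ∣) → member S i ∈ S
member-∈ (inside  ∷ S) zero    = here
member-∈ (inside  ∷ S) (suc i) = there (member-∈ S i)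
member-∈ (outside ∷ S) i       = there (member-∈ S i)

member-injective : (S : Subset k) → Injective _≡_ _≡_ (member S)
member-injective (inside  ∷ S) {zero}  {zero}  _ = refl
member-injective (inside  ∷ S) {suc i} {suc j} e = cong suc (member-injective S (suc-injective e))
member-injective (outside ∷ S)                 e = member-injective S (suc-injective e)

position : (S : Subset k) {x : Fin k} → x ∈ S → Fin ∣ S ∣
position (inside  ∷ S) here      = zero
position (inside  ∷ S) (there h) = suc (position S h)
position (outside ∷ S) (there h) = position S h

member-position : (S : Subset k) {x : Fin k} (x∈S : x ∈ S) → member S (position S x∈S) ≡ x
member-position (inside  ∷ S) here      = refl
member-position (inside  ∷ S) (there h) = cong suc (member-position S h)
member-position (outside ∷ S) (there h) = cong suc (member-position S h)

record Enumeration (S : Subset k) (c : ℕ) : Set where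
  field
    elem           : Fin c → Fin k
    elem-∈         : ∀ i → elem i ∈ S
    elem-injective : Injective _≡_ _≡_ elem

open Enumeration

Exhaustive : (S : Subset k) → Enumeration S c → Set
Exhaustive S E = ∀ {x} → x ∈ S → ∃ λ i → elem E i ≡ x

enumerate : (S : Subset k) → ∣ S ∣ ≡ c → Σ (Enumeration S c) (Exhaustive S)
enumerate S refl =
  record { elem = member S ; elem-∈ = member-∈ S ; elem-injective = member-injective S }
  , λ x∈S → position S x∈S , member-position S x∈S

enumerate-except : (S : Subset k) {x : Fin k} → ∣ S ∣ ≡ suc c → x ∈ S →
                   Σ (Enumeration S c) λ E → ∀ i → elem E i ≢ x
enumerate-except S e x∈S with enumerate S e
... | E , onto with onto x∈S
...   | i₀ , refl =
  record { elem = elem E ∘ punchIn i₀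
         ; elem-∈ = elem-∈ E ∘ punchIn i₀
         ; elem-injective = punchIn-injective i₀ _ _ ∘ elem-injective E }
  , λ i → punchInᵢ≢i i₀ i ∘ elem-injective E

enumeration⇒≤ : {S : Subset k} → Enumeration S c → c ≤ ∣ S ∣
enumeration⇒≤ {S = S} E = injective⇒≤ λ {i} {j} e → elem-injective E (begin
  elem E i                              ≡⟨ member-position S (elem-∈ E i) ⟨
  member S (position S (elem-∈ E i))    ≡⟨ cong (member S) e ⟩
  member S (position S (elem-∈ E j))    ≡⟨ member-position S (elem-∈ E j) ⟩
  elem E j                              ∎)
  where open ≡-Reasoning

∣p∣≡1+n⇒Nonempty : (S : Subset k) → ∣ S ∣ ≡ suc c → Nonempty S
∣p∣≡1+n⇒Nonempty S e = elem E zero , elem-∈ E zero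
  where E = proj₁ (enumerate S e)

∣p∣≡1⇒x≡y : (S : Subset k) {x y : Fin k} → ∣ S ∣ ≡ 1 → x ∈ S → y ∈ S → x ≡ y
∣p∣≡1⇒x≡y S e x∈S y∈S with enumerate S e
... | E , onto with onto x∈S | onto y∈S
...   | zero , refl | zero , refl = refl

module _ {n} (A : PurePartialPlane n) where

  private
    Point = Fin (numPoints n)

  linesThrough⁺ : ∀ {p l} → p ∈ line A l → l ∈ linesThrough A p
  linesThrough⁺ {l = l} p∈l = lookup⇒[]= l _ (trans (lookup∘tabulate _ l) ([]=⇒lookup p∈l))

  linesThrough⁻ : ∀ {p l} → l ∈ linesThrough A p → p ∈ line A l
  linesThrough⁻ {p} {l} l∋p = lookup⇒[]= p _ (trans (sym (lookup∘tabulate _ l)) ([]=⇒lookup l∋p))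

  meet : ∀ {l m} → l ≢ m → ∃ λ r → r ∈ line A l × r ∈ line A m
  meet {l} {m} l≢m with ∣p∣≡1+n⇒Nonempty (line A l ∩ line A m) (line-meet A l m l≢m)
  ... | r , r∈l∩m = r , x∈p∩q⁻ (line A l) (line A m) r∈l∩m

  meet-unique : ∀ {l m x y} → l ≢ m → x ∈ line A l → x ∈ line A m →
                y ∈ line A l → y ∈ line A m → x ≡ y
  meet-unique {l} {m} l≢m x∈l x∈m y∈l y∈m =
    ∣p∣≡1⇒x≡y (line A l ∩ line A m) (line-meet A l m l≢m) (x∈p∩q⁺ (x∈l , x∈m)) (x∈p∩q⁺ (y∈l , y∈m))

  -- The n + 1 lines through q each carry n further points, all distinct: 1 + (n + 1)n points.
  full-pencil-covers : ∀ {q} → ∣ linesThrough A q ∣ ≡ suc n → ∀ p → ¬ (∀ l → p ∉ line A l)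
  full-pencil-covers {q} deg p p-isolated =
    <-irrefl numPoints≡ (injective∧missing⇒< pencil-injective p pencil≢p)
    where
    numPoints≡ : suc (suc n * n) ≡ numPoints n
    numPoints≡ = trans (cong suc (+-comm n (n * n))) (+-comm 1 (n * n + n))

    L : Enumeration (linesThrough A q) (suc n)
    L = proj₁ (enumerate (linesThrough A q) deg)

    q∈L : ∀ i → q ∈ line A (elem L i)
    q∈L i = linesThrough⁻ (elem-∈ L i)

    off-q : ∀ i → Σ (Enumeration (line A (elem L i)) n) λ E → ∀ k → elem E k ≢ q
    off-q i = enumerate-except (line A (elem L i)) (line-card A (elem L i)) (q∈L i)

    point : Fin (suc n) × Fin n → Point
    point (i , k) = elem (proj₁ (off-q i)) k

    point∈L : ∀ i k → point (i , k) ∈ line A (elem L i)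
    point∈L i k = elem-∈ (proj₁ (off-q i)) k

    point-injective : Injective _≡_ _≡_ point
    point-injective {i , k} {i′ , k′} e with i ≟ i′
    ... | yes refl = cong (i ,_) (elem-injective (proj₁ (off-q i)) e)
    ... | no i≢i′  = ⊥-elim (proj₂ (off-q i) k (sym
          (meet-unique (i≢i′ ∘ elem-injective L) (q∈L i) (q∈L i′)
                       (point∈L i k) (subst (_∈ line A (elem L i′)) (sym e) (point∈L i′ k′)))))

    pencil : Fin (suc (suc n * n)) → Point
    pencil zero    = q
    pencil (suc x) = point (Inverse.to *↔× x)

    pencil-injective : Injective _≡_ _≡_ pencil
    pencil-injective {zero}  {zero}  _ = refl
    pencil-injective {zero}  {suc y} e = ⊥-elim (proj₂ (off-q _) _ (sym e))
    pencil-injective {suc x} {zero}  e = ⊥-elim (proj₂ (off-q _) _ e)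
    pencil-injective {suc x} {suc y} e = cong suc (↔-injective *↔× (point-injective e))

    pencil≢p : ∀ x → pencil x ≢ p
    pencil≢p zero    refl = p-isolated (elem L zero) (q∈L zero)
    pencil≢p (suc x) refl = p-isolated _ (point∈L _ _)

module _ {n} (C : PurePartialPlane n) where

  Adj-sym : ∀ {u v} → Adj C u v → Adj C v u
  Adj-sym {inj₁ _} {inj₂ _} a = a
  Adj-sym {inj₂ _} {inj₁ _} a = a

  point-neighbour : ∀ {p} v → Adj C (inj₁ p) v → ∃ λ l → v ≡ inj₂ l
  point-neighbour (inj₂ l) _ = l , refl

  line-neighbour : ∀ {l} v → Adj C (inj₂ l) v → ∃ λ p → v ≡ inj₁ p
  line-neighbour (inj₁ p) _ = p , refl

module GraphIsoProperties {n} {A B : PurePartialPlane n} (G : GraphIso A B) where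

  open Inverse (proj₁ G) public using (to; from; strictlyInverseˡ)

  to-injective : Injective _≡_ _≡_ to
  to-injective = ↔-injective (proj₁ G)

  from-injective : Injective _≡_ _≡_ from
  from-injective = ↔-injective (↔-sym (proj₁ G))

  from≡⇒to≡ : ∀ {u y} → from y ≡ u → to u ≡ y
  from≡⇒to≡ refl = strictlyInverseˡ _

  adj⁺ : ∀ {u v x y} → to u ≡ x → to v ≡ y → Adj A u v → Adj B x y
  adj⁺ {u} {v} refl refl = Equivalence.to (proj₂ G u v)

  adj⁻ : ∀ {u v x y} → to u ≡ x → to v ≡ y → Adj B x y → Adj A u v
  adj⁻ {u} {v} refl refl = Equivalence.from (proj₂ G u v)

GraphIso-sym : ∀ {n} {A B : PurePartialPlane n} → GraphIso A B → GraphIso B A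
GraphIso-sym G = ↔-sym (proj₁ G) , λ u v →
  mk⇔ (adj⁻ (strictlyInverseˡ u) (strictlyInverseˡ v)) (adj⁺ (strictlyInverseˡ u) (strictlyInverseˡ v))
  where open GraphIsoProperties G

module FlippedLine {n} {A B : PurePartialPlane n} (G : GraphIso A B)
                   {l₀ b₀} (l₀↦b₀ : Inverse.to (proj₁ G) (inj₂ l₀) ≡ inj₁ b₀) where

  open GraphIsoProperties G

  line↦point : ∀ l → ∃ λ b → to (inj₂ l) ≡ inj₁ b
  line↦point l with l ≟ l₀
  ... | yes refl = b₀ , l₀↦b₀
  ... | no l≢l₀ with meet A l≢l₀
  ...   | r , r∈l , r∈l₀ with point-neighbour B (to (inj₁ r)) (Adj-sym B (adj⁺ {inj₁ r} refl l₀↦b₀ r∈l₀))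
  ...     | m , r↦m = line-neighbour B (to (inj₂ l)) (adj⁺ {inj₁ r} r↦m refl r∈l)

  lineImage : Fin (size A) → Fin (numPoints n)
  lineImage = proj₁ ∘ line↦point

  lineImage-injective : Injective _≡_ _≡_ lineImage
  lineImage-injective {l} {l′} e = inj₂-injective (to-injective (begin
    to (inj₂ l)             ≡⟨ proj₂ (line↦point l) ⟩
    inj₁ (lineImage l)      ≡⟨ cong inj₁ e ⟩
    inj₁ (lineImage l′)     ≡⟨ proj₂ (line↦point l′) ⟨
    to (inj₂ l′)            ∎))
    where open ≡-Reasoning

  on-line↦line : ∀ {p l} → p ∈ line A l → ∃ λ m → to (inj₁ p) ≡ inj₂ m
  on-line↦line {p} {l} p∈l =
    point-neighbour B (to (inj₁ p)) (Adj-sym B (adj⁺ {inj₁ p} refl (proj₂ (line↦point l)) p∈l))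

  degree : ∀ {p m} → to (inj₁ p) ≡ inj₂ m → ∣ linesThrough A p ∣ ≡ suc n
  degree {p} {m} p↦m = ≤-antisym
    (subst (_ ≤_) (line-card B m) (enumeration⇒≤ images))
    (subst (_≤ _) (line-card B m) (enumeration⇒≤ preimages))
    where
    images : Enumeration (line B m) ∣ linesThrough A p ∣
    images = record
      { elem           = lineImage ∘ member (linesThrough A p)
      ; elem-∈         = λ i → adj⁺ p↦m (proj₂ (line↦point _))
                                   (linesThrough⁻ A (member-∈ (linesThrough A p) i))
      ; elem-injective = member-injective (linesThrough A p) ∘ lineImage-injective
      }

    preimage : ∀ i → ∃ λ l → from (inj₁ (member (line B m) i)) ≡ inj₂ l
    preimage i = point-neighbour A _ (adj⁻ p↦m (strictlyInverseˡ _) (member-∈ (line B m) i))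

    preimages : Enumeration (linesThrough A p) ∣ line B m ∣
    preimages = record
      { elem           = proj₁ ∘ preimage
      ; elem-∈         = λ i → linesThrough⁺ A
          (adj⁻ p↦m (from≡⇒to≡ (proj₂ (preimage i))) (member-∈ (line B m) i))
      ; elem-injective = λ {i} {j} e → member-injective (line B m) (inj₁-injective (from-injective
          (trans (proj₂ (preimage i)) (trans (cong inj₂ e) (sym (proj₂ (preimage j)))))))
      }

  point↦line : ∀ p → ∃ λ m → to (inj₁ p) ≡ inj₂ m
  point↦line p with to (inj₁ p) in p↦
  ... | inj₂ m = m , refl
  ... | inj₁ _ = ⊥-elim (full-pencil-covers A full-pencil p p-isolated)
    where
    q₀ : Nonempty (line A l₀)
    q₀ = ∣p∣≡1+n⇒Nonempty (line A l₀) (line-card A l₀)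

    full-pencil : ∣ linesThrough A (proj₁ q₀) ∣ ≡ suc n
    full-pencil = degree (proj₂ (on-line↦line (proj₂ q₀)))

    p-isolated : ∀ l → p ∉ line A l
    p-isolated l p∈l with trans (sym p↦) (proj₂ (on-line↦line p∈l))
    ... | ()

  point↤line : ∀ b → ∃ λ l → from (inj₁ b) ≡ inj₂ l
  point↤line b with from (inj₁ b) in b↤
  ... | inj₂ l = l , refl
  ... | inj₁ p with point↦line p
  ...   | m , p↦m with trans (sym (from≡⇒to≡ b↤)) p↦m
  ...     | ()

  size≡numPoints : size A ≡ numPoints n
  size≡numPoints = cantor-schröder-bernstein lineImage-injective λ {b} {b′} e →
    inj₁-injective (from-injective
      (trans (proj₂ (point↤line b)) (trans (cong inj₂ e) (sym (proj₂ (point↤line b′))))))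

  joining-line : ∀ p q → p ≢ q → Σ (Fin (size A)) λ l → (p ∈ line A l × q ∈ line A l)
                                   × (∀ m → p ∈ line A m → q ∈ line A m → m ≡ l)
  joining-line p q p≢q with point↦line p | point↦line q
  ... | mp , p↦mp | mq , q↦mq with meet B mp≢mq
    where
    mp≢mq : mp ≢ mq
    mp≢mq e = p≢q (inj₁-injective (to-injective (trans p↦mp (trans (cong inj₂ e) (sym q↦mq)))))
  ... | r , r∈mp , r∈mq with point↤line r
  ... | l , r↤l = l , (p∈l , q∈l) , unique
    where
    p∈l : p ∈ line A l
    p∈l = adj⁻ p↦mp (from≡⇒to≡ r↤l) r∈mp
    q∈l : q ∈ line A l
    q∈l = adj⁻ q↦mq (from≡⇒to≡ r↤l) r∈mq
    unique : ∀ m → p ∈ line A m → q ∈ line A m → m ≡ l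
    unique m p∈m q∈m with m ≟ l
    ... | yes m≡l = m≡l
    ... | no m≢l  = ⊥-elim (p≢q (meet-unique A m≢l p∈m p∈l q∈m q∈l))

  projective : IsProjectivePlane A
  projective = size≡numPoints , (λ p → degree (proj₂ (point↦line p))) , joining-line

inj₂-preserved⇒inj₁-reflected : ∀ {X Y X′ Y′ : Set} (ι : (X ⊎ Y) ↔ (X′ ⊎ Y′)) →
  (∀ y → ∃ λ y′ → Inverse.to ι (inj₂ y) ≡ inj₂ y′) →
  ∀ x′ → ∃ λ x → Inverse.from ι (inj₁ x′) ≡ inj₁ x
inj₂-preserved⇒inj₁-reflected ι to-inj₂ x′ with Inverse.from ι (inj₁ x′) in x′↤
... | inj₁ x = x , refl
... | inj₂ y with to-inj₂ y
...   | y′ , y↦y′ with trans (sym y↦y′) (trans (cong (Inverse.to ι) (sym x′↤)) (Inverse.strictlyInverseˡ ι _))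
...     | ()

nonprojective⇒line↦line : ∀ {n} {A B : PurePartialPlane n} → ¬ IsProjectivePlane A → (G : GraphIso A B) →
                          ∀ l → ∃ λ m → Inverse.to (proj₁ G) (inj₂ l) ≡ inj₂ m
nonprojective⇒line↦line ¬projective G l with Inverse.to (proj₁ G) (inj₂ l) in l↦
... | inj₂ m = m , refl
... | inj₁ _ = ⊥-elim (¬projective (FlippedLine.projective G l↦))

module _ {n} {A B : PurePartialPlane n} where

  PPPIso⇒GraphIso : PPPIso A B → GraphIso A B
  PPPIso⇒GraphIso (φ , ψ , incidence) = (φ ⊎-↔ ψ) , adjacency
    where
    adjacency : ∀ u v → Adj A u v ⇔ Adj B (Inverse.to (φ ⊎-↔ ψ) u) (Inverse.to (φ ⊎-↔ ψ) v)
    adjacency (inj₁ p) (inj₂ l) = incidence p l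
    adjacency (inj₂ l) (inj₁ p) = incidence p l
    adjacency (inj₁ _) (inj₁ _) = mk⇔ (λ ()) (λ ())
    adjacency (inj₂ _) (inj₂ _) = mk⇔ (λ ()) (λ ())

  GraphIso⇒PPPIso : ¬ IsProjectivePlane A → ¬ IsProjectivePlane B → GraphIso A B → PPPIso A B
  GraphIso⇒PPPIso ¬projA ¬projB G = proj₁ φ , proj₁ ψ , λ p l →
    mk⇔ (adj⁺ (proj₂ φ p) (proj₂ ψ l)) (adj⁻ (proj₂ φ p) (proj₂ ψ l))
    where
    open GraphIsoProperties G
    line↦line : ∀ l → ∃ λ m → to (inj₂ l) ≡ inj₂ m
    line↦line = nonprojective⇒line↦line ¬projA G

    line↤line : ∀ m → ∃ λ l → from (inj₂ m) ≡ inj₂ l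
    line↤line = nonprojective⇒line↦line ¬projB (GraphIso-sym G)

    φ : Σ (Fin (numPoints n) ↔ Fin (numPoints n)) λ φ → ∀ p → to (inj₁ p) ≡ inj₁ (Inverse.to φ p)
    φ = ↔-restrict (proj₁ G) inj₁-injective inj₁-injective
          (inj₂-preserved⇒inj₁-reflected (↔-sym (proj₁ G)) line↤line)
          (inj₂-preserved⇒inj₁-reflected (proj₁ G) line↦line)

    ψ : Σ (Fin (size A) ↔ Fin (size B)) λ ψ → ∀ l → to (inj₂ l) ≡ inj₂ (Inverse.to ψ l)
    ψ = ↔-restrict (proj₁ G) inj₂-injective inj₂-injective line↦line line↤line

theorem4 : (n : ℕ) (A B : PurePartialPlane n) →
    ¬ IsProjectivePlane A → ¬ IsProjectivePlane B →
    PPPIso A B ⇔ GraphIso A B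
theorem4 n A B ¬projA ¬projB = mk⇔ PPPIso⇒GraphIso (GraphIso⇒PPPIso ¬projA ¬projB)
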